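{- Let $G$ be a graph, $r$ a positive integer, $L_S=(s_1,\dots,s_n)$ a subordering of $S\subseteq V(G)$, and $v\in V(G)\setminus S$. Let $L_{S\cup\{v\}}$ be a subordering of $S\cup\{v\}$ such that $L_{S\cup\{v\}}[S]=L_S$. Then \[\mathrm{Wreach}_r(G,L_{S\cup\{v\}},v)\setminus\{v\}=\{s\in \mathrm{bp}(G,L_S,v)\mid s\preceq_{L_{S\cup\{v\}}} v\}.\]
   Context: All graphs are finite, simple and undirected. The length of a path is its number of edges (a single vertex is a path of length $0$). A subordering $L_S$ of a graph $G$ is a linear ordering of a subset $S\subseteq V(G)$; we write $u\preceq_{L_S} w$ if $u=w$ or $u$ precedes $w$ in $L_S$, and $L_{S'}[S]$ denotes the restriction of a subordering $L_{S'}$ to $S\subseteq S'$. Given a subordering $L_S$ and vertices $u,x\in V(G)$, we say $u\in \mathrm{Wreach}_r(G,L_S,x)$ if either $u=x$, or $u\in S$ and there is a path $P$ between $u$ and $x$ of length at most $r$ such that $u\preceq_{L_S} w$ for all $w\in V(P)\cap S$. For $L_S=(s_1,\dots,s_n)$ and $v\notin S$: $\mathrm{placeafter}(L_S,s_i,v)=(s_1,\dots,s_i,v,s_{i+1},\dots,s_n)$ and $\mathrm{placebefore}(L_S,s_i,v)=(s_1,\dots,s_{i-1},v,s_i,\dots,s_n)$. A vertex $s\in S$ is a breakpoint of $v$ if $\mathrm{Wreach}_r(G,\mathrm{placebefore}(L_S,s,v),v)\ne \mathrm{Wreach}_r(G,\mathrm{placeafter}(L_S,s,v),v)$; $\mathrm{bp}(G,L_S,v)\subseteq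 S$ denotes the set of breakpoints of $v$. -}

module Defs where

open import Level using (0ℓ)
open import Data.Nat using (ℕ; suc; _≤_)
open import Data.Fin using (Fin)
open import Data.Fin.Properties using (_≟_)
open import Data.List using (List; []; _∷_; _++_; length; filter)
open import Data.List.Membership.Propositional using (_∈_; _∉_)
open import Data.List.Relation.Unary.Any using (any?)
open import Data.List.Relation.Unary.Unique.Propositional using (Unique)
open import Data.Product using (Σ; ∃; ∃-syntax; _×_; _,_)
open import Data.Sum using (_⊎_)
open import Relation.Nullary using (Dec; yes; no; ¬_)
open import Relation.Binary.PropositionalEquality using (_≡_)
open import Function.Bundles using (_⇔_)

record Graph : Set₁ where
  field
    n     : ℕ
    Adj   : Fin n → Fin n → Set
    adj?  : ∀ x y → Dec (Adj x y)
    sym   : ∀ {x y} → Adj x y → Adj y x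
    irrefl : ∀ {x} → ¬ Adj x x

open Graph public

V : Graph → Set
V G = Fin (n G)

-- A subordering: a duplicate-free list of vertices (its set of entries is S).
Subordering : Graph → Set
Subordering G = List (V G)

IsSubordering : (G : Graph) → Subordering G → Set
IsSubordering G L = Unique L

Precedes : (G : Graph) → Subordering G → V G → V G → Set
Precedes G L u w = ∃[ xs ] ∃[ ys ] (L ≡ xs ++ (u ∷ ys) × w ∈ ys)

Preceq : (G : Graph) → Subordering G → V G → V G → Set
Preceq G L u w = u ≡ w ⊎ Precedes G L u w

restrict : (G : Graph) → Subordering G → List (V G) → Subordering G
restrict G L' S = filter (λ x → any? (λ y → x ≟ y) S) L'

data Chain (G : Graph) : List (V G) → Set where
  single : ∀ x → Chain G (x ∷ [])
  step   : ∀ {x y ps} → Adj G x y → Chain G (y ∷ ps) → Chain G (x ∷ y ∷ ps)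

data Last {A : Set} : List A → A → Set where
  last-single : ∀ x → Last (x ∷ []) x
  last-cons   : ∀ {x xs y} → Last xs y → Last (x ∷ xs) y

-- P is a path from u to x of length (number of edges) at most r
record PathBetween (G : Graph) (r : ℕ) (u x : V G) (P : List (V G)) : Set where
  field
    chain  : Chain G P
    unique : Unique P
    start  : ∃[ ps ] (P ≡ u ∷ ps)
    end    : Last P x
    short  : length P ≤ suc r

Wreach : (G : Graph) → ℕ → Subordering G → V G → V G → Set
Wreach G r L x u =
  u ≡ x ⊎
  (u ∈ L × ∃[ P ] (PathBetween G r u x P ×
                   (∀ w → w ∈ P → w ∈ L → Preceq G L u w)))

placeafter : (G : Graph) → Subordering G → V G → V G → Subordering G
placeafter G [] s v = []
placeafter G (x ∷ xs) s v with x ≟ s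
... | yes _ = x ∷ v ∷ xs
... | no  _ = x ∷ placeafter G xs s v

placebefore : (G : Graph) → Subordering G → V G → V G → Subordering G
placebefore G [] s v = []
placebefore G (x ∷ xs) s v with x ≟ s
... | yes _ = v ∷ x ∷ xs
... | no  _ = x ∷ placebefore G xs s v

IsBreakpoint : (G : Graph) → ℕ → Subordering G → V G → V G → Set
IsBreakpoint G r L v s =
  s ∈ L × ¬ (∀ u → Wreach G r (placebefore G L s v) v u ⇔ Wreach G r (placeafter G L s v) v u)

-- For u ≠ v and any ordering M of L ∪ {v} restricting to L, u ∈ Wreach_r(G, M, v) holds exactly
-- when u ∈ L, some path of length at most r from u to v has u as its L-least vertex (WreachPath),
-- and u precedes v in M: on L the order of M is that of L, and v is the endpoint of the path.
-- Placing v just before or just after s changes the set of vertices preceding v by s alone, so the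
-- two weak reachability sets differ exactly when WreachPath holds for s. Since breakpoints are
-- defined by a negation, recovering that path uses that WreachPath is decidable: paths of bounded
-- length are finitely many.

module Submission where

open import Defs hiding (sym)
open import Data.Nat using (ℕ; _<_; zero; suc; _≤_; s≤s)
open import Data.Nat.Properties using (_≤?_)
open import Data.Fin.Properties using (_≟_)
open import Data.List using (List; []; _∷_; _++_; [_]; length; filter; cartesianProductWith; allFin)
open import Data.List.Properties using (++-assoc; filter-all; filter-reject; filter-accept)
open import Data.List.Membership.Propositional using (_∈_; _∉_; lose)
open import Data.List.Membership.Propositional.Properties
  using (∈-++⁺ˡ; ∈-++⁺ʳ; ∈-++⁻; ∈-filter⁺; ∈-filter⁻; ∈-cartesianProductWith⁺; ∈-allFin)
import Data.List.Membership.DecPropositional as DecMembership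
open import Data.List.Relation.Unary.Any using (here; there; any?; satisfied)
open import Data.List.Relation.Unary.All as All using (All; all?; []; _∷_)
import Data.List.Relation.Unary.Unique.DecPropositional as DecUnique
open import Data.Sum using (_⊎_; inj₁; inj₂; [_,_]′)
open import Data.Sum.Function.Propositional using (_⊎-⇔_)
open import Data.Product using (_×_; _,_; proj₁; proj₂; ∃-syntax; ∃₂; uncurry)
open import Data.Product.Function.NonDependent.Propositional using (_×-⇔_)
open import Data.Empty using (⊥-elim)
open import Function using (id; _∘_)
open import Function.Bundles using (_⇔_; mk⇔; Equivalence)
open import Function.Construct.Identity using (⇔-id)
open import Function.Construct.Composition using (_⇔-∘_)
open import Function.Construct.Symmetry using (⇔-sym)
open import Level using (Level)
open import Relation.Nullary using (¬_; Dec; yes; no)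
open import Relation.Nullary.Decidable using (_⊎-dec_; _×-dec_; _→-dec_; map′; decidable-stable)
open import Relation.Unary using (Pred; Decidable)
open import Relation.Binary.Definitions using (DecidableEquality)
open import Relation.Binary.PropositionalEquality using (_≡_; refl; sym; trans; cong; subst; subst₂)

open Equivalence using (to; from)

data Before {A : Set} (a b : A) : List A → Set where
  here  : ∀ {ys} → b ∈ ys → Before a b (a ∷ ys)
  there : ∀ {x ys} → Before a b ys → Before a b (x ∷ ys)

module _ {A : Set} where

  private variable
    a b v x : A
    L xs zs : List A

  Before-∈ʳ : Before a b L → b ∈ L
  Before-∈ʳ (here b∈) = there b∈
  Before-∈ʳ (there p) = there (Before-∈ʳ p)

  Before-insert⇔∈ : ∀ xs → v ∉ zs → Before a v (xs ++ v ∷ zs) ⇔ a ∈ xs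
  Before-insert⇔∈ {v} {zs} {a} xs v∉zs = mk⇔ (before xs) (after xs)
    where
    before : ∀ xs → Before a v (xs ++ v ∷ zs) → a ∈ xs
    before []       (here v∈zs) = ⊥-elim (v∉zs v∈zs)
    before []       (there p)   = ⊥-elim (v∉zs (Before-∈ʳ p))
    before (x ∷ xs) (here _)    = here refl
    before (x ∷ xs) (there p)   = there (before xs p)
    after : ∀ xs → a ∈ xs → Before a v (xs ++ v ∷ zs)
    after (x ∷ xs) (here refl) = here (∈-++⁺ʳ xs (here refl))
    after (x ∷ xs) (there a∈)  = there (after xs a∈)

  ∈-insert⇔ : ∀ xs → x ∈ xs ++ v ∷ zs ⇔ (x ∈ xs ++ zs ⊎ x ≡ v)
  ∈-insert⇔ [] = mk⇔ (λ { (here x≡v) → inj₂ x≡v ; (there x∈) → inj₁ x∈ }) [ there , here ]′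
  ∈-insert⇔ (y ∷ xs) =
    mk⇔ (λ { (here x≡y) → inj₁ (here x≡y)
           ; (there x∈)  → [ inj₁ ∘ there , inj₂ ]′ (to (∈-insert⇔ xs) x∈) })
        (λ { (inj₁ (here x≡y)) → here x≡y
           ; (inj₁ (there x∈)) → there (from (∈-insert⇔ xs) (inj₁ x∈))
           ; (inj₂ x≡v)        → there (from (∈-insert⇔ xs) (inj₂ x≡v)) })

  module _ {ℓ : Level} {P : Pred A ℓ} (P? : Decidable P) where

    Before-filter⁺ : P a → P b → Before a b L → Before a b (filter P? L)
    Before-filter⁺ {a} Pa Pb (here {ys} b∈)
      rewrite filter-accept P? {x = a} {xs = ys} Pa = here (∈-filter⁺ P? b∈ Pb)
    Before-filter⁺ Pa Pb (there {x} p) with P? x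
    ... | yes _ = there (Before-filter⁺ Pa Pb p)
    ... | no  _ = Before-filter⁺ Pa Pb p

    Before-filter⁻ : ∀ L → Before a b (filter P? L) → Before a b L
    Before-filter⁻ (x ∷ xs) p with P? x
    Before-filter⁻ (x ∷ xs) (here b∈) | yes _ = here (proj₁ (∈-filter⁻ P? b∈))
    Before-filter⁻ (x ∷ xs) (there p) | yes _ = there (Before-filter⁻ xs p)
    ... | no _ = there (Before-filter⁻ xs p)

    filter-insert : ∀ xs → All P xs → ¬ P v → All P zs → filter P? (xs ++ v ∷ zs) ≡ xs ++ zs
    filter-insert [] _ ¬Pv Pzs = trans (filter-reject P? ¬Pv) (filter-all P? Pzs)
    filter-insert (x ∷ xs) (Px ∷ Pxs) ¬Pv Pzs =
      trans (filter-accept P? Px) (cong (x ∷_) (filter-insert xs Pxs ¬Pv Pzs))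

  before? : DecidableEquality A → ∀ a b L → Dec (Before a b L)
  before? _≟ₐ_ a b [] = no λ ()
  before? _≟ₐ_ a b (x ∷ ys) =
    map′ [ (λ { (refl , b∈) → here b∈ }) , there ]′
         (λ { (here b∈) → inj₁ (refl , b∈) ; (there p) → inj₂ p })
         ((a ≟ₐ x ×-dec any? (b ≟ₐ_) ys) ⊎-dec before? _≟ₐ_ a b ys)

  listsUpTo : List A → ℕ → List (List A)
  listsUpTo xs zero    = [] ∷ []
  listsUpTo xs (suc k) = [] ∷ cartesianProductWith _∷_ xs (listsUpTo xs k)

  ∈-listsUpTo : ∀ k {P} → All (_∈ xs) P → length P ≤ k → P ∈ listsUpTo xs k
  ∈-listsUpTo zero    []         _         = here refl
  ∈-listsUpTo (suc k) []         _         = here refl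
  ∈-listsUpTo (suc k) (x∈ ∷ P∈) (s≤s len) =
    there (∈-cartesianProductWith⁺ _∷_ x∈ (∈-listsUpTo k P∈ len))

module _ {G : Graph} where

  open DecMembership {A = V G} _≟_ using (_∈?_)

  private variable
    a b s v x : V G
    L M P xs zs : List (V G)

  Precedes⇔Before : Precedes G L a b ⇔ Before a b L
  Precedes⇔Before = mk⇔ (λ { (xs , ys , refl , b∈) → prefix xs b∈ }) split
    where
    prefix : ∀ xs {ys} → b ∈ ys → Before a b (xs ++ a ∷ ys)
    prefix []       b∈ = here b∈
    prefix (x ∷ xs) b∈ = there (prefix xs b∈)
    split : Before a b L → Precedes G L a b
    split (here {ys} b∈) = [] , ys , refl , b∈
    split (there {x} p) with split p
    ... | xs , ys , refl , b∈ = x ∷ xs , ys , refl , b∈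

  Before-restrict : restrict G M L ≡ L → a ∈ L → b ∈ L → Before a b M ⇔ Before a b L
  Before-restrict {M} {L} {a} {b} restricts a∈L b∈L = mk⇔
    (subst (Before a b) restricts ∘ Before-filter⁺ (_∈? L) a∈L b∈L)
    (Before-filter⁻ (_∈? L) M ∘ subst (Before a b) (sym restricts))

  Preceq-restrict : restrict G M L ≡ L → a ∈ L → b ∈ L → Preceq G M a b ⇔ Preceq G L a b
  Preceq-restrict restricts a∈L b∈L =
    ⇔-id _ ⊎-⇔ (⇔-sym Precedes⇔Before ⇔-∘ (Before-restrict restricts a∈L b∈L ⇔-∘ Precedes⇔Before))

  restrict-insert : ∀ xs → v ∉ xs ++ zs → restrict G (xs ++ v ∷ zs) (xs ++ zs) ≡ xs ++ zs
  restrict-insert xs v∉ =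
    filter-insert (_∈? _) xs (All.tabulate ∈-++⁺ˡ) v∉ (All.tabulate (∈-++⁺ʳ xs))

  Last-∈ : Last P x → x ∈ P
  Last-∈ (last-single x) = here refl
  Last-∈ (last-cons l)   = there (Last-∈ l)

  placements-split : s ∈ L →
    ∃₂ λ xs ys → s ∉ xs × L ≡ xs ++ s ∷ ys ×
                 placebefore G L s v ≡ xs ++ v ∷ s ∷ ys × placeafter G L s v ≡ (xs ++ [ s ]) ++ v ∷ ys
  placements-split {s} {x ∷ L} s∈ with x ≟ s | s∈
  ... | yes refl | _ = [] , L , (λ ()) , refl , refl , refl
  ... | no x≢s | here s≡x = ⊥-elim (x≢s (sym s≡x))
  ... | no x≢s | there s∈L with placements-split s∈L
  ...   | xs , ys , s∉xs , refl , before , after =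
    x ∷ xs , ys , [ x≢s ∘ sym , s∉xs ]′ ∘ uncons , refl , cong (x ∷_) before , cong (x ∷_) after
    where
    uncons : s ∈ x ∷ xs → s ≡ x ⊎ s ∈ xs
    uncons (here s≡x) = inj₁ s≡x
    uncons (there s∈) = inj₂ s∈

  chain? : ∀ (P : List (V G)) → Dec (Chain G P)
  chain? []           = no λ ()
  chain? (x ∷ [])     = yes (single x)
  chain? (x ∷ y ∷ ps) =
    map′ (uncurry step) (λ { (step xy c) → xy , c }) (adj? G x y ×-dec chain? (y ∷ ps))

  starts? : ∀ (a : V G) (P : List (V G)) → Dec (∃[ ps ] (P ≡ a ∷ ps))
  starts? a []       = no λ ()
  starts? a (y ∷ ps) = map′ (λ { refl → ps , refl }) (λ { (_ , refl) → refl }) (a ≟ y)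

  last? : ∀ (P : List (V G)) x → Dec (Last P x)
  last? []           x = no λ ()
  last? (y ∷ [])     x =
    map′ (λ { refl → last-single y }) (λ { (last-single _) → refl ; (last-cons ()) }) (y ≟ x)
  last? (y ∷ z ∷ zs) x = map′ last-cons (λ { (last-cons l) → l }) (last? (z ∷ zs) x)

  pathBetween? : ∀ r (a b : V G) P → Dec (PathBetween G r a b P)
  pathBetween? r a b P =
    map′ (λ (c , u , s , e , l) → record { chain = c ; unique = u ; start = s ; end = e ; short = l })
         (λ p → let open PathBetween p in chain , unique , start , end , short)
         (chain? P ×-dec DecUnique.unique? _≟_ P ×-dec starts? a P ×-dec last? P b ×-dec
          length P ≤? suc r)

  preceq? : ∀ (L : Subordering G) a b → Dec (Preceq G L a b)
  preceq? L a b = a ≟ b ⊎-dec map′ (from Precedes⇔Before) (to Precedes⇔Before) (before? _≟_ a b L)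

module _ (G : Graph) (r : ℕ) where

  open DecMembership {A = V G} _≟_ using (_∈?_)

  private variable
    s u v x : V G
    L M xs ys zs : List (V G)

  MinimalOn : Subordering G → V G → List (V G) → Set
  MinimalOn L u P = ∀ w → w ∈ P → w ∈ L → Preceq G L u w

  WreachPath : Subordering G → V G → V G → Set
  WreachPath L v u = ∃[ P ] (PathBetween G r u v P × MinimalOn L u P)

  wreachPath? : ∀ L v u → Dec (WreachPath L v u)
  wreachPath? L v u =
    map′ satisfied
         (λ { (P , path , minimal) →
                lose (∈-listsUpTo (suc r) everyVertex (PathBetween.short path)) (path , minimal) })
         (any? (λ P → pathBetween? r u v P ×-dec minimal? P) (listsUpTo (allFin (n G)) (suc r)))
    where
    everyVertex : ∀ {P} → All (_∈ allFin (n G)) P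
    everyVertex = All.tabulate (λ _ → ∈-allFin _)
    minimal? : ∀ (P : List (V G)) → Dec (MinimalOn L u P)
    minimal? P = map′ (λ all w → All.lookup all) (λ f → All.tabulate (f _))
                      (all? (λ w → w ∈? L →-dec preceq? {G} L u w) P)

  wreach-extension : (∀ x → x ∈ M ⇔ (x ∈ L ⊎ x ≡ v)) → restrict G M L ≡ L → ¬ u ≡ v →
                     Wreach G r M v u ⇔ (u ∈ L × WreachPath L v u × Before u v M)
  wreach-extension {M} {L} {v} {u} members restricts u≢v = mk⇔ reached reaches
    where
    ∈M : ∀ {x} → x ∈ L → x ∈ M
    ∈M x∈L = from (members _) (inj₁ x∈L)

    reached : Wreach G r M v u → u ∈ L × WreachPath L v u × Before u v M
    reached (inj₁ u≡v) = ⊥-elim (u≢v u≡v)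
    reached (inj₂ (u∈M , P , path , minimal)) = u∈L , (P , path , minimalL) , u<v
      where
      u∈L : u ∈ L
      u∈L = [ id , ⊥-elim ∘ u≢v ]′ (to (members u) u∈M)
      u<v : Before u v M
      u<v = [ ⊥-elim ∘ u≢v , to (Precedes⇔Before {G}) ]′
              (minimal v (Last-∈ {G} (PathBetween.end path)) (from (members v) (inj₂ refl)))
      minimalL : MinimalOn L u P
      minimalL w w∈P w∈L = to (Preceq-restrict {G} restricts u∈L w∈L) (minimal w w∈P (∈M w∈L))

    reaches : u ∈ L × WreachPath L v u × Before u v M → Wreach G r M v u
    reaches (u∈L , (P , path , minimal) , u<v) = inj₂ (∈M u∈L , P , path , minimalM)
      where
      minimalM : MinimalOn M u P
      minimalM w w∈P w∈M with to (members w) w∈M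
      ... | inj₁ w∈L = from (Preceq-restrict {G} restricts u∈L w∈L) (minimal w w∈P w∈L)
      ... | inj₂ refl = inj₂ (from (Precedes⇔Before {G}) u<v)

  wreach-insert : ∀ xs → L ≡ xs ++ zs → v ∉ L → ¬ x ≡ v →
                  Wreach G r (xs ++ v ∷ zs) v x ⇔ (x ∈ L × WreachPath L v x × x ∈ xs)
  wreach-insert xs refl v∉L x≢v =
    (⇔-id _ ×-⇔ ⇔-id _ ×-⇔ Before-insert⇔∈ xs (v∉L ∘ ∈-++⁺ʳ xs))
      ⇔-∘ wreach-extension (λ _ → ∈-insert⇔ xs) (restrict-insert {G} xs v∉L) x≢v

  SameWreach : Subordering G → Subordering G → V G → Set
  SameWreach M N v = ∀ x → Wreach G r M v x ⇔ Wreach G r N v x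

  split-placements-differ⇔ :
    v ∉ xs ++ s ∷ ys → s ∉ xs →
    (¬ SameWreach (xs ++ v ∷ s ∷ ys) ((xs ++ [ s ]) ++ v ∷ ys) v) ⇔
    WreachPath (xs ++ s ∷ ys) v s
  split-placements-differ⇔ {v} {xs} {s} {ys} v∉L s∉xs = mk⇔ differ→path path→differ
    where
    S : Subordering G
    S = xs ++ s ∷ ys

    before : ¬ x ≡ v → Wreach G r (xs ++ v ∷ s ∷ ys) v x ⇔ (x ∈ S × WreachPath S v x × x ∈ xs)
    before = wreach-insert xs refl v∉L

    after : ¬ x ≡ v →
            Wreach G r ((xs ++ [ s ]) ++ v ∷ ys) v x ⇔ (x ∈ S × WreachPath S v x × x ∈ xs ++ [ s ])
    after = wreach-insert (xs ++ [ s ]) (sym (++-assoc xs [ s ] ys)) v∉L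

    s≢v : ¬ s ≡ v
    s≢v refl = v∉L (∈-++⁺ʳ xs (here refl))

    path→differ : WreachPath S v s →
      ¬ SameWreach (xs ++ v ∷ s ∷ ys) ((xs ++ [ s ]) ++ v ∷ ys) v
    path→differ path same =
      s∉xs (proj₂ (proj₂ (to (before s≢v) (from (same s)
        (from (after s≢v) (∈-++⁺ʳ xs (here refl) , path , ∈-++⁺ʳ xs (here refl)))))))

    agree : ¬ WreachPath S v s → SameWreach (xs ++ v ∷ s ∷ ys) ((xs ++ [ s ]) ++ v ∷ ys) v
    agree ¬path x with x ≟ v
    ... | yes refl = mk⇔ (λ _ → inj₁ refl) (λ _ → inj₁ refl)
    ... | no x≢v = ⇔-sym (after x≢v) ⇔-∘ (mk⇔ widen narrow ⇔-∘ before x≢v)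
      where
      widen : x ∈ S × WreachPath S v x × x ∈ xs → x ∈ S × WreachPath S v x × x ∈ xs ++ [ s ]
      widen (x∈S , path , x∈xs) = x∈S , path , ∈-++⁺ˡ x∈xs
      narrow : x ∈ S × WreachPath S v x × x ∈ xs ++ [ s ] → x ∈ S × WreachPath S v x × x ∈ xs
      narrow (x∈S , path , x∈xs+s) with ∈-++⁻ xs x∈xs+s
      ... | inj₁ x∈xs       = x∈S , path , x∈xs
      ... | inj₂ (here refl) = ⊥-elim (¬path path)

    differ→path : ¬ SameWreach (xs ++ v ∷ s ∷ ys) ((xs ++ [ s ]) ++ v ∷ ys) v →
                  WreachPath S v s
    differ→path differ = decidable-stable (wreachPath? S v s) (differ ∘ agree)

  breakpoint⇔ : v ∉ L → IsBreakpoint G r L v s ⇔ (s ∈ L × WreachPath L v s)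
  breakpoint⇔ {v} {L} {s} v∉L =
    mk⇔ (λ (s∈L , differ) → s∈L , to (differ⇔ s∈L) differ)
        (λ (s∈L , path) → s∈L , from (differ⇔ s∈L) path)
    where
    differ⇔ : s ∈ L →
      (¬ SameWreach (placebefore G L s v) (placeafter G L s v) v) ⇔
      WreachPath L v s
    differ⇔ s∈L with placements-split s∈L
    ... | xs , ys , s∉xs , refl , before , after =
      subst₂ (λ B A → (¬ SameWreach B A v) ⇔ WreachPath L v s) (sym before) (sym after)
             (split-placements-differ⇔ v∉L s∉xs)

lemma8 : (G : Graph) (r : ℕ) → 0 < r →
         (L : Subordering G) → IsSubordering G L →
         (v : V G) → v ∉ L →
         (L' : Subordering G) → IsSubordering G L' →
         (∀ x → (x ∈ L' ⇔ (x ∈ L ⊎ x ≡ v))) →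
         restrict G L' L ≡ L →
         ∀ u → ((Wreach G r L' v u × ¬ u ≡ v) ⇔ (IsBreakpoint G r L v u × Preceq G L' u v))
-- Neither 0 < r nor the uniqueness of the entries of L and L' is needed.
lemma8 G r _ L _ v v∉L L' _ members restricts u = mk⇔ reached reaches
  where
  extension : ¬ u ≡ v → Wreach G r L' v u ⇔ (u ∈ L × WreachPath G r L v u × Before u v L')
  extension = wreach-extension G r members restricts

  reached : Wreach G r L' v u × ¬ u ≡ v → IsBreakpoint G r L v u × Preceq G L' u v
  reached (reach , u≢v) with to (extension u≢v) reach
  ... | u∈L , path , u<v =
    from (breakpoint⇔ G r v∉L) (u∈L , path) , inj₂ (from (Precedes⇔Before {G}) u<v)

  reaches : IsBreakpoint G r L v u × Preceq G L' u v → Wreach G r L' v u × ¬ u ≡ v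
  reaches (breakpoint , u⪯v) with to (breakpoint⇔ G r v∉L) breakpoint
  ... | u∈L , path = from (extension u≢v) (u∈L , path , u<v) , u≢v
    where
    u≢v : ¬ u ≡ v
    u≢v refl = v∉L u∈L
    u<v : Before u v L'
    u<v = [ ⊥-elim ∘ u≢v , to (Precedes⇔Before {G}) ]′ u⪯v
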